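{- For every $n\ge 1$, the number of even dashings and the number of odd dashings of the $n$-cubical chromotopology $I^n_c$ are \[ |e(I^n_c)|=|o(I^n_c)|=2^{2^n-1}. \]
   Context: $I^n_c$ is the graph with vertex set $\mathbf{Z}_2^n$ and an edge of color $i$ between $v$ and $v+e_i$ for each $i\in[n]$ ($e_i$ the $i$-th standard basis vector). A $2$-colored $4$-cycle is a $4$-cycle whose edges use exactly two colors. A dashing is a map $d\colon E(I^n_c)\to\mathbf{Z}_2$; it is odd (resp. even) if the sum of $d$ over every $2$-colored $4$-cycle is $1$ (resp. $0$). $o(\cdot)$ and $e(\cdot)$ denote the sets of odd and even dashings. -}

module Defs where

open import Data.Nat using (ℕ)
open import Data.Bool using (Bool; true; false; not; _xor_)
open import Data.Fin using (Fin)
open import Data.Vec using (Vec; lookup; _[_]≔_; updateAt)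
open import Data.Vec.Properties using (lookup∘update)
open import Data.Product using (Σ; _,_; proj₁)
open import Relation.Binary.PropositionalEquality using (_≡_; _≢_)
open import Relation.Binary.Bundles using (Setoid)
open import Level using (0ℓ)

-- Z₂ is modelled by Bool, with addition _xor_.

Vertex : ℕ → Set
Vertex n = Vec Bool n

flipAt : ∀ {n} → Vertex n → Fin n → Vertex n
flipAt v i = updateAt v i not

-- An edge of color i joins v and v + e_i.  Each (undirected) edge is
-- represented uniquely by its color i and its endpoint whose i-th
-- coordinate is 0 (false).
record Edge (n : ℕ) : Set where
  constructor edge
  field
    color : Fin n
    low   : Vertex n
    lowOk : lookup low color ≡ false

edgeAt : ∀ {n} → Vertex n → Fin n → Edge n
edgeAt v i = edge i (v [ i ]≔ false) (lookup∘update i v false)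

Dashing : ℕ → Set
Dashing n = Edge n → Bool

-- Sum of d over the 2-colored 4-cycle  v, v+e_i, v+e_i+e_j, v+e_j  (i ≢ j).
-- Every 2-colored 4-cycle of I^n_c is of this form.
squareSum : ∀ {n} → Dashing n → Vertex n → Fin n → Fin n → Bool
squareSum d v i j =
  d (edgeAt v i) xor (d (edgeAt (flipAt v i) j) xor
  (d (edgeAt (flipAt v j) i) xor d (edgeAt v j)))

IsOdd : ∀ {n} → Dashing n → Set
IsOdd {n} d = ∀ (v : Vertex n) (i j : Fin n) → i ≢ j → squareSum d v i j ≡ true

IsEven : ∀ {n} → Dashing n → Set
IsEven {n} d = ∀ (v : Vertex n) (i j : Fin n) → i ≢ j → squareSum d v i j ≡ false

dashingSetoid : ∀ n → (Dashing n → Set) → Setoid 0ℓ 0ℓ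
dashingSetoid n P = record
  { Carrier = Σ (Dashing n) P
  ; _≈_ = λ a b → ∀ (e : Edge n) → proj₁ a e ≡ proj₁ b e
  ; isEquivalence = record
    { refl = λ e → Relation.Binary.PropositionalEquality.refl
    ; sym = λ p e → Relation.Binary.PropositionalEquality.sym (p e)
    ; trans = λ p q e → Relation.Binary.PropositionalEquality.trans (p e) (q e)
    }
  }

OddDashings : ℕ → Setoid 0ℓ 0ℓ
OddDashings n = dashingSetoid n IsOdd

EvenDashings : ℕ → Setoid 0ℓ 0ℓ
EvenDashings n = dashingSetoid n IsEven

-- An even dashing is a Z₂-valued 1-cocycle on the 2-skeleton of the cube. The cube is
-- simply connected, so every such cocycle is the coboundary δg of a vertex labelling g,
-- and g is unique once it is normalised by g(0) = 0. Even dashings are therefore in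
-- bijection with the functions Z₂ⁿ → Z₂ vanishing at the origin, of which there are
-- 2^(2ⁿ − 1). Adding a fixed odd dashing exchanges even and odd dashings, so there are
-- equally many odd ones.
module Submission where

open import Defs
open import Algebra.Bundles using (CommutativeMonoid; CommutativeRing)
open import Data.Bool using (Bool; true; false; not; _xor_; _≟_)
open import Data.Bool.Properties
  using (xor-∧-commutativeRing; xor-assoc; xor-comm; xor-same; xor-identityʳ; xor-inverseˡ;
         not-distribˡ-xor; not-involutive)
open import Data.Fin using (Fin; zero; suc)
open import Data.Fin.Properties using (*↔×; 1↔⊤; 2↔Bool; suc-injective)
open import Data.Nat using (ℕ; zero; suc; _≤_; _+_; _^_; _∸_)
open import Data.Nat.Properties using (^-distribˡ-+-*; ^-identityʳ; +-identityʳ; +-∸-comm; m^n>0)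
open import Data.Product using (_×_; _,_; proj₁)
open import Data.Product.Function.NonDependent.Propositional using (_×-↔_)
open import Data.Unit using (⊤; tt)
open import Data.Vec using ([]; _∷_; lookup; replicate; _[_]≔_)
open import Data.Vec.Properties
  using ([]≔-lookup; updateAt-cong-local; updateAt-updateAt; updateAt-id-local; updateAt-commutes)
open import Function.Bundles using (Inverse; _↔_)
open import Function.Construct.Composition using (inverse; _↔-∘_)
open import Function.Properties.Inverse using (↔-refl)
open import Relation.Binary.Bundles using (Setoid)
open import Relation.Binary.Construct.On as On using ()
open import Relation.Binary.PropositionalEquality
  using (_≡_; _≢_; refl; sym; trans; cong; cong₂; setoid; _→-setoid_; module ≡-Reasoning)
open import Axiom.UniquenessOfIdentityProofs using (module Decidable⇒UIP)
open import Level using (0ℓ)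

open ≡-Reasoning

xor-commutativeMonoid : CommutativeMonoid 0ℓ 0ℓ
xor-commutativeMonoid = CommutativeRing.+-commutativeMonoid xor-∧-commutativeRing

open import Algebra.Solver.CommutativeMonoid xor-commutativeMonoid using (solve; _⊜_; _⊕_)

private
  variable
    n k : ℕ
    A : Set

xor-cancelˡ : ∀ x y → x xor (x xor y) ≡ y
xor-cancelˡ x y = trans (sym (xor-assoc x x y)) (cong (_xor y) (xor-same x))

xor-cancelʳ : ∀ x y → (x xor y) xor y ≡ x
xor-cancelʳ x y = trans (xor-assoc x y y) (trans (cong (x xor_) (xor-same y)) (xor-identityʳ x))

xor≡false⇒≡ : ∀ {x y} → x xor y ≡ false → x ≡ y
xor≡false⇒≡ {false} {false} _ = refl
xor≡false⇒≡ {true}  {true}  _ = refl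
xor≡false⇒≡ {false} {true}  ()
xor≡false⇒≡ {true}  {false} ()

origin : ∀ n → Vertex n
origin n = replicate n false

[]≔false-self : ∀ {v : Vertex n} {i} → lookup v i ≡ false → v [ i ]≔ false ≡ v
[]≔false-self {v = v} {i} p = trans (cong (v [ i ]≔_) (sym p)) ([]≔-lookup v i)

[]≔false-flipAt : ∀ {v : Vertex n} {i} → lookup v i ≡ true → v [ i ]≔ false ≡ flipAt v i
[]≔false-flipAt {v = v} {i} p = updateAt-cong-local i v (sym (cong not p))

flipAt-involutive : ∀ (v : Vertex n) i → flipAt (flipAt v i) i ≡ v
flipAt-involutive v i = trans (updateAt-updateAt i v) (updateAt-id-local i v (not-involutive _))

flipAt-commutes : ∀ (v : Vertex n) {i j} → i ≢ j → flipAt (flipAt v j) i ≡ flipAt (flipAt v i) j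
flipAt-commutes v {i} {j} i≢j = updateAt-commutes i j i≢j v

edge-≡ : ∀ {i : Fin n} {w w′} {p : lookup w i ≡ false} {q : lookup w′ i ≡ false} →
         w ≡ w′ → edge i w p ≡ edge i w′ q
edge-≡ {p = p} {q} refl = cong (edge _ _) (Decidable⇒UIP.≡-irrelevant _≟_ p q)

edgeAt-low : ∀ {v : Vertex n} {i} (p : lookup v i ≡ false) → edgeAt v i ≡ edge i v p
edgeAt-low p = edge-≡ ([]≔false-self p)

_xorᵈ_ : Dashing n → Dashing n → Dashing n
(d xorᵈ d′) e = d e xor d′ e

xor-interchange₄ : ∀ a a′ b b′ c c′ e e′ →
  (a xor a′) xor ((b xor b′) xor ((c xor c′) xor (e xor e′)))
    ≡ (a xor (b xor (c xor e))) xor (a′ xor (b′ xor (c′ xor e′)))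
xor-interchange₄ = solve 8
  (λ a a′ b b′ c c′ e e′ → (a ⊕ a′) ⊕ ((b ⊕ b′) ⊕ ((c ⊕ c′) ⊕ (e ⊕ e′)))
                         ⊜ (a ⊕ (b ⊕ (c ⊕ e))) ⊕ (a′ ⊕ (b′ ⊕ (c′ ⊕ e′))))
  refl

xor-reverse₄ : ∀ a b c e → a xor (b xor (c xor e)) ≡ e xor (c xor (b xor a))
xor-reverse₄ = solve 4 (λ a b c e → a ⊕ (b ⊕ (c ⊕ e)) ⊜ e ⊕ (c ⊕ (b ⊕ a))) refl

squareSum-xorᵈ : ∀ (d d′ : Dashing n) v i j →
                 squareSum (d xorᵈ d′) v i j ≡ squareSum d v i j xor squareSum d′ v i j
squareSum-xorᵈ d d′ v i j = xor-interchange₄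
  (d (edgeAt v i)) (d′ (edgeAt v i)) (d (edgeAt (flipAt v i) j)) (d′ (edgeAt (flipAt v i) j))
  (d (edgeAt (flipAt v j) i)) (d′ (edgeAt (flipAt v j) i)) (d (edgeAt v j)) (d′ (edgeAt v j))

squareSum-sym : ∀ (d : Dashing n) v i j → squareSum d v i j ≡ squareSum d v j i
squareSum-sym d v i j =
  xor-reverse₄ (d (edgeAt v i)) (d (edgeAt (flipAt v i) j)) (d (edgeAt (flipAt v j) i)) (d (edgeAt v j))

xorᵈ-even-odd : ∀ (d d′ : Dashing n) → IsEven d → IsOdd d′ → IsOdd (d xorᵈ d′)
xorᵈ-even-odd d d′ even odd v i j i≢j =
  trans (squareSum-xorᵈ d d′ v i j) (cong₂ _xor_ (even v i j i≢j) (odd v i j i≢j))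

xorᵈ-odd-odd : ∀ (d d′ : Dashing n) → IsOdd d → IsOdd d′ → IsEven (d xorᵈ d′)
xorᵈ-odd-odd d d′ odd odd′ v i j i≢j =
  trans (squareSum-xorᵈ d d′ v i j) (cong₂ _xor_ (odd v i j i≢j) (odd′ v i j i≢j))

xorᵈ-inverse : ∀ (d₀ : Dashing n) → IsOdd d₀ → Inverse (EvenDashings n) (OddDashings n)
xorᵈ-inverse d₀ odd₀ = record
  { to        = λ (d , even) → d xorᵈ d₀ , xorᵈ-even-odd d d₀ even odd₀
  ; from      = λ (d , odd) → d xorᵈ d₀ , xorᵈ-odd-odd d d₀ odd odd₀
  ; to-cong   = λ d≈d′ e → cong (_xor d₀ e) (d≈d′ e)
  ; from-cong = λ d≈d′ e → cong (_xor d₀ e) (d≈d′ e)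
  ; inverse   = (λ {x} d≈ e → trans (cong (_xor d₀ e) (d≈ e)) (xor-cancelʳ (proj₁ x e) (d₀ e)))
              , (λ {x} d≈ e → trans (cong (_xor d₀ e) (d≈ e)) (xor-cancelʳ (proj₁ x e) (d₀ e)))
  }

constant-even : ∀ b → IsEven {n} (λ _ → b)
constant-even false v i j _ = refl
constant-even true  v i j _ = refl

prefixParity : Fin n → Vertex n → Bool
prefixParity zero    _       = false
prefixParity (suc i) (b ∷ w) = b xor prefixParity i w

-- The sign w₀ + ⋯ + w_{i−1} of the Jordan–Wigner realisation of anticommuting
-- Clifford generators.
cliffordDashing : Dashing n
cliffordDashing (edge i w _) = prefixParity i w

cliffordDashing-odd : IsOdd (cliffordDashing {n})
cliffordDashing-odd (b ∷ w) zero zero 0≢0 with () ← 0≢0 refl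
cliffordDashing-odd (b ∷ w) zero (suc j) _ =
  trans (cong (_xor (b xor x)) (sym (not-distribˡ-xor b x))) (xor-inverseˡ (b xor x))
  where x = prefixParity j (w [ j ]≔ false)
cliffordDashing-odd (b ∷ w) (suc i) zero _ =
  trans (squareSum-sym cliffordDashing (b ∷ w) (suc i) zero)
        (cliffordDashing-odd (b ∷ w) zero (suc i) λ ())
-- On the face x₀ = b the dashing is the constant b plus the Clifford dashing of dimension n.
cliffordDashing-odd (b ∷ w) (suc i) (suc j) i≢j =
  trans (squareSum-xorᵈ (λ _ → b) cliffordDashing w i j)
        (cong₂ _xor_ (constant-even b w i j i≢j′) (cliffordDashing-odd w i j i≢j′))
  where i≢j′ = λ i≡j → i≢j (cong suc i≡j)

δ : (Vertex n → Bool) → Dashing n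
δ g (edge i w _) = g w xor g (flipAt w i)

δ-cong : ∀ {g h : Vertex n → Bool} → (∀ v → g v ≡ h v) → ∀ e → δ g e ≡ δ h e
δ-cong g≗h (edge i w _) = cong₂ _xor_ (g≗h w) (g≗h (flipAt w i))

δ-edgeAt : ∀ (g : Vertex n → Bool) v i → δ g (edgeAt v i) ≡ g v xor g (flipAt v i)
δ-edgeAt g v i with lookup v i in eq
... | false = cong (δ g) (edgeAt-low eq)
... | true  = begin
  g (v [ i ]≔ false) xor g (flipAt (v [ i ]≔ false) i)
    ≡⟨ cong (λ u → g u xor g (flipAt u i)) ([]≔false-flipAt eq) ⟩
  g (flipAt v i) xor g (flipAt (flipAt v i) i)
    ≡⟨ cong (λ u → g (flipAt v i) xor g u) (flipAt-involutive v i) ⟩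
  g (flipAt v i) xor g v
    ≡⟨ xor-comm (g (flipAt v i)) (g v) ⟩
  g v xor g (flipAt v i) ∎

xor-telescope : ∀ a b c d → (a xor b) xor ((b xor c) xor ((d xor c) xor (a xor d))) ≡ false
xor-telescope a b c d = begin
  (a xor b) xor ((b xor c) xor ((d xor c) xor (a xor d)))
    ≡⟨ solve 4 (λ a b c d → (a ⊕ b) ⊕ ((b ⊕ c) ⊕ ((d ⊕ c) ⊕ (a ⊕ d)))
                          ⊜ (a ⊕ a) ⊕ ((b ⊕ b) ⊕ ((c ⊕ c) ⊕ (d ⊕ d)))) refl a b c d ⟩
  (a xor a) xor ((b xor b) xor ((c xor c) xor (d xor d)))
    ≡⟨ cong₂ _xor_ (xor-same a) (cong₂ _xor_ (xor-same b) (cong₂ _xor_ (xor-same c) (xor-same d))) ⟩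
  false ∎

δ-even : ∀ (g : Vertex n → Bool) → IsEven (δ g)
δ-even g v i j i≢j
  rewrite δ-edgeAt g v i | δ-edgeAt g (flipAt v i) j | δ-edgeAt g (flipAt v j) i | δ-edgeAt g v j
        | flipAt-commutes v i≢j
  = xor-telescope (g v) (g (flipAt v i)) (g (flipAt (flipAt v i) j)) (g (flipAt v j))

lowerFace : Dashing (suc n) → Dashing n
lowerFace d (edge i w p) = d (edge (suc i) (false ∷ w) p)

rung : Dashing (suc n) → Vertex n → Bool
rung d w = d (edge zero (false ∷ w) refl)

-- The sum of d along a path from the origin to v that first runs inside the face x₀ = 0.
potential : Dashing n → Vertex n → Bool
potential {zero}  d []          = false
potential {suc n} d (false ∷ w) = potential (lowerFace d) w
potential {suc n} d (true ∷ w)  = potential (lowerFace d) w xor rung d w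

potential-origin : ∀ (d : Dashing n) → potential d (origin n) ≡ false
potential-origin {zero}  d = refl
potential-origin {suc n} d = potential-origin (lowerFace d)

potential-cong : ∀ {d d′ : Dashing n} → (∀ e → d e ≡ d′ e) → ∀ v → potential d v ≡ potential d′ v
potential-cong {zero}  d≈d′ [] = refl
potential-cong {suc n} d≈d′ (false ∷ w) = potential-cong (λ (edge i u p) → d≈d′ _) w
potential-cong {suc n} d≈d′ (true ∷ w)  =
  cong₂ _xor_ (potential-cong (λ (edge i u p) → d≈d′ _) w) (d≈d′ _)

lowerFace-even : ∀ (d : Dashing (suc n)) → IsEven d → IsEven (lowerFace d)
lowerFace-even d even v i j i≢j = even (false ∷ v) (suc i) (suc j) (λ i≡j → i≢j (suc-injective i≡j))

δ-potential : ∀ {d : Dashing n} → IsEven d → ∀ e → δ (potential d) e ≡ d e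
δ-potential {suc n} {d} even (edge zero (false ∷ w) p) =
  trans (xor-cancelˡ (potential (lowerFace d) w) (rung d w)) (cong d (edge-≡ refl))
δ-potential {suc n} {d} even (edge (suc i) (false ∷ w) p) =
  δ-potential (lowerFace-even d even) (edge i w p)
-- The edge of the upper face is determined by the square it spans with the lower face.
δ-potential {suc n} {d} even (edge (suc i) (true ∷ w) p) = xor≡false⇒≡ (begin
  ((P w xor r w) xor (P wᵢ xor r wᵢ)) xor top
    ≡⟨ solve 5 (λ a b c e t → ((a ⊕ b) ⊕ (c ⊕ e)) ⊕ t ⊜ b ⊕ (t ⊕ (e ⊕ (a ⊕ c))))
             refl (P w) (r w) (P wᵢ) (r wᵢ) top ⟩
  r w xor (top xor (r wᵢ xor (P w xor P wᵢ)))
    ≡⟨ cong (λ x → r w xor (top xor (r wᵢ xor x))) bottom≡ ⟩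
  r w xor (top xor (r wᵢ xor bottom))
    ≡⟨ square ⟩
  false ∎)
  where
  P = potential (lowerFace d)
  r = rung d
  wᵢ = flipAt w i
  top = d (edge (suc i) (true ∷ w) p)
  bottom = d (edge (suc i) (false ∷ w) p)
  bottom≡ : P w xor P wᵢ ≡ bottom
  bottom≡ = δ-potential (lowerFace-even d even) (edge i w p)
  square : r w xor (top xor (r wᵢ xor bottom)) ≡ false
  square = trans
    (sym (cong₂ _xor_ (cong d (edgeAt-low refl))
         (cong₂ _xor_ (cong d (edgeAt-low p))
         (cong₂ _xor_ (cong d (edgeAt-low refl)) (cong d (edgeAt-low p))))))
    (even (false ∷ w) zero (suc i) λ ())

lowerFace-δ : ∀ (g : Vertex (suc n) → Bool) e → lowerFace (δ g) e ≡ δ (λ w → g (false ∷ w)) e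
lowerFace-δ g (edge i w p) = refl

potential-δ : ∀ (g : Vertex n → Bool) → g (origin n) ≡ false → ∀ v → potential (δ g) v ≡ g v
potential-δ {zero}  g g₀ [] = sym g₀
potential-δ {suc n} g g₀ (false ∷ w) =
  trans (potential-cong (lowerFace-δ g) w) (potential-δ (λ u → g (false ∷ u)) g₀ w)
potential-δ {suc n} g g₀ (true ∷ w) = begin
  potential (lowerFace (δ g)) w xor (g (false ∷ w) xor g (true ∷ w))
    ≡⟨ cong (_xor (g (false ∷ w) xor g (true ∷ w)))
            (trans (potential-cong (lowerFace-δ g) w) (potential-δ (λ u → g (false ∷ u)) g₀ w)) ⟩
  g (false ∷ w) xor (g (false ∷ w) xor g (true ∷ w))
    ≡⟨ xor-cancelˡ (g (false ∷ w)) (g (true ∷ w)) ⟩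
  g (true ∷ w) ∎

NormalisedFunctions : {A : Set} → A → ℕ → Setoid 0ℓ 0ℓ
NormalisedFunctions {A} a₀ n =
  On.setoid (Vertex n →-setoid A) (proj₁ {B = λ f → f (origin n) ≡ a₀})

δ-inverse : Inverse (NormalisedFunctions false n) (EvenDashings n)
δ-inverse = record
  { to        = λ (g , _) → δ g , δ-even g
  ; from      = λ (d , _) → potential d , potential-origin d
  ; to-cong   = δ-cong
  ; from-cong = potential-cong
  ; inverse   = (λ {(d , even)} g≈ e → trans (δ-cong g≈ e) (δ-potential even e))
              , (λ {(g , g₀)} d≈ v → trans (potential-cong d≈ v) (potential-δ g g₀ v))
  }

Table : Set → ℕ → Set
Table A zero    = A
Table A (suc n) = Table A n × Table A n

lookupᵀ : Table A n → Vertex n → A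
lookupᵀ {n = zero}  a        []          = a
lookupᵀ {n = suc n} (t₀ , _) (false ∷ w) = lookupᵀ t₀ w
lookupᵀ {n = suc n} (_ , t₁) (true ∷ w)  = lookupᵀ t₁ w

tabulateᵀ : (Vertex n → A) → Table A n
tabulateᵀ {n = zero}  f = f []
tabulateᵀ {n = suc n} f = tabulateᵀ (λ w → f (false ∷ w)) , tabulateᵀ (λ w → f (true ∷ w))

lookupᵀ∘tabulateᵀ : ∀ (f : Vertex n → A) v → lookupᵀ (tabulateᵀ f) v ≡ f v
lookupᵀ∘tabulateᵀ {n = zero}  f []          = refl
lookupᵀ∘tabulateᵀ {n = suc n} f (false ∷ w) = lookupᵀ∘tabulateᵀ (λ u → f (false ∷ u)) w
lookupᵀ∘tabulateᵀ {n = suc n} f (true ∷ w)  = lookupᵀ∘tabulateᵀ (λ u → f (true ∷ u)) w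

tabulateᵀ∘lookupᵀ : ∀ (t : Table A n) → tabulateᵀ {n = n} (lookupᵀ t) ≡ t
tabulateᵀ∘lookupᵀ {n = zero}  t         = refl
tabulateᵀ∘lookupᵀ {n = suc n} (t₀ , t₁) =
  cong₂ _,_ (tabulateᵀ∘lookupᵀ {n = n} t₀) (tabulateᵀ∘lookupᵀ {n = n} t₁)

tabulateᵀ-cong : ∀ {f g : Vertex n → A} → (∀ v → f v ≡ g v) → tabulateᵀ f ≡ tabulateᵀ g
tabulateᵀ-cong {n = zero}  f≗g = f≗g []
tabulateᵀ-cong {n = suc n} f≗g =
  cong₂ _,_ (tabulateᵀ-cong (λ w → f≗g (false ∷ w))) (tabulateᵀ-cong (λ w → f≗g (true ∷ w)))

-- Tables of the functions taking a prescribed value at the origin; that value is not stored.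
Table₀ : Set → ℕ → Set
Table₀ A zero    = ⊤
Table₀ A (suc n) = Table₀ A n × Table A n

tabulate₀ : (Vertex n → A) → Table₀ A n
tabulate₀ {n = zero}  f = tt
tabulate₀ {n = suc n} f = tabulate₀ (λ w → f (false ∷ w)) , tabulateᵀ (λ w → f (true ∷ w))

tabulate₀-cong : ∀ {f g : Vertex n → A} → (∀ v → f v ≡ g v) → tabulate₀ f ≡ tabulate₀ g
tabulate₀-cong {n = zero}  f≗g = refl
tabulate₀-cong {n = suc n} f≗g =
  cong₂ _,_ (tabulate₀-cong (λ w → f≗g (false ∷ w))) (tabulateᵀ-cong (λ w → f≗g (true ∷ w)))

module _ (a₀ : A) where

  lookup₀ : Table₀ A n → Vertex n → A
  lookup₀ {n = zero}  _        []          = a₀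
  lookup₀ {n = suc n} (t₀ , _) (false ∷ w) = lookup₀ t₀ w
  lookup₀ {n = suc n} (_ , t₁) (true ∷ w)  = lookupᵀ t₁ w

  lookup₀-origin : ∀ (t : Table₀ A n) → lookup₀ t (origin n) ≡ a₀
  lookup₀-origin {n = zero}  t        = refl
  lookup₀-origin {n = suc n} (t₀ , _) = lookup₀-origin {n = n} t₀

  lookup₀∘tabulate₀ : ∀ (f : Vertex n → A) → f (origin n) ≡ a₀ → ∀ v → lookup₀ (tabulate₀ f) v ≡ f v
  lookup₀∘tabulate₀ {n = zero}  f f₀ []          = sym f₀
  lookup₀∘tabulate₀ {n = suc n} f f₀ (false ∷ w) = lookup₀∘tabulate₀ (λ u → f (false ∷ u)) f₀ w
  lookup₀∘tabulate₀ {n = suc n} f f₀ (true ∷ w)  = lookupᵀ∘tabulateᵀ (λ u → f (true ∷ u)) w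

  tabulate₀∘lookup₀ : ∀ (t : Table₀ A n) → tabulate₀ {n = n} (lookup₀ t) ≡ t
  tabulate₀∘lookup₀ {n = zero}  tt        = refl
  tabulate₀∘lookup₀ {n = suc n} (t₀ , t₁) =
    cong₂ _,_ (tabulate₀∘lookup₀ {n = n} t₀) (tabulateᵀ∘lookupᵀ {n = n} t₁)

  Table₀-inverse : Inverse (setoid (Table₀ A n)) (NormalisedFunctions a₀ n)
  Table₀-inverse = record
    { to        = λ t → lookup₀ t , lookup₀-origin t
    ; from      = λ (f , _) → tabulate₀ f
    ; to-cong   = λ { refl v → refl }
    ; from-cong = tabulate₀-cong
    ; inverse   = (λ { {f , f₀} refl v → lookup₀∘tabulate₀ f f₀ v })
                , (λ {t} f≈ → trans (tabulate₀-cong f≈) (tabulate₀∘lookup₀ t))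
    }

Fin-cong : ∀ {m n} → m ≡ n → Fin m ↔ Fin n
Fin-cong refl = ↔-refl

Fin-^-+ : ∀ k a b → Fin (k ^ (a + b)) ↔ (Fin (k ^ a) × Fin (k ^ b))
Fin-^-+ k a b = *↔× ↔-∘ Fin-cong (^-distribˡ-+-* k a b)

2^suc : ∀ n → 2 ^ suc n ≡ 2 ^ n + 2 ^ n
2^suc n = cong (2 ^ n +_) (+-identityʳ (2 ^ n))

2^suc∸1 : ∀ n → 2 ^ suc n ∸ 1 ≡ (2 ^ n ∸ 1) + 2 ^ n
2^suc∸1 n = trans (cong (_∸ 1) (2^suc n)) (+-∸-comm (2 ^ n) (m^n>0 2 n))

Table-count : Fin k ↔ A → Fin (k ^ 2 ^ n) ↔ Table A n
Table-count {k} {n = zero}  k↔A = k↔A ↔-∘ Fin-cong (^-identityʳ k)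
Table-count {k} {n = suc n} k↔A =
  (Table-count k↔A ×-↔ Table-count k↔A)
    ↔-∘ (Fin-^-+ k (2 ^ n) (2 ^ n) ↔-∘ Fin-cong (cong (k ^_) (2^suc n)))

Table₀-count : Fin k ↔ A → Fin (k ^ (2 ^ n ∸ 1)) ↔ Table₀ A n
Table₀-count {n = zero}  k↔A = 1↔⊤
Table₀-count {k} {n = suc n} k↔A =
  (Table₀-count k↔A ×-↔ Table-count k↔A)
    ↔-∘ (Fin-^-+ k (2 ^ n ∸ 1) (2 ^ n) ↔-∘ Fin-cong (cong (k ^_) (2^suc∸1 n)))

mainTheorem10 : ∀ (n : ℕ) → 1 ≤ n →
    Inverse (setoid (Fin (2 ^ (2 ^ n ∸ 1)))) (EvenDashings n)
    × Inverse (setoid (Fin (2 ^ (2 ^ n ∸ 1)))) (OddDashings n)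
mainTheorem10 n _ = even , inverse even (xorᵈ-inverse cliffordDashing cliffordDashing-odd)
  where
  even : Inverse (setoid (Fin (2 ^ (2 ^ n ∸ 1)))) (EvenDashings n)
  even = inverse (inverse (Table₀-count 2↔Bool) (Table₀-inverse false)) δ-inverse
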